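{- Let $n\ge 4$ be even. If two vertices $v_1,v_2\in V_n$ of the Goldbach factorization graph $F_n$ satisfy $v_1+v_2=n$, then $\{v_1,v_2\}$ induces a source strongly connected component of $F_n$ (a strongly connected component with no incoming arcs from vertices outside it).
   Context: For an even integer $n\ge 4$, the Goldbach factorization graph is the directed weighted graph $F_n=(V_n,A_n,w_n)$ with vertex set $V_n=[2,n-2]\cap\mathbb{P}$ ($\mathbb{P}$ the set of primes), arc set $A_n=\{(s,t)\in V_n^2 : s \mid (n-t)\}$ (loops allowed), and weights $w_n((s,t))=\max\{e\ge 1: s^e\mid (n-t)\}$. -}

module Defs where

open import Data.Nat using (ℕ; _≤_; _∸_)
open import Data.Nat.Divisibility using (_∣_)
open import Data.Nat.Primality using (Prime)
open import Data.Product using (_×_; ∃)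
open import Relation.Nullary using (¬_)
open import Relation.Binary.Construct.Closure.ReflexiveTransitive using (Star)

Vertex : ℕ → ℕ → Set
Vertex n v = 2 ≤ v × v ≤ n ∸ 2 × Prime v

Arc : ℕ → ℕ → ℕ → Set
Arc n s t = Vertex n s × Vertex n t × s ∣ (n ∸ t)

Reach : ℕ → ℕ → ℕ → Set
Reach n = Star (Arc n)

IsSCC : ℕ → (ℕ → Set) → Set
IsSCC n C =
  (∀ x → C x → Vertex n x) ×
  ∃ C ×
  (∀ x y → C x → C y → Reach n x y) ×
  (∀ x y → C x → Vertex n y → Reach n x y → Reach n y x → C y)

NoIncoming : ℕ → (ℕ → Set) → Set
NoIncoming n C = ∀ s t → Arc n s t → C t → ¬ (¬ C s)


IsSourceSCC : ℕ → (ℕ → Set) → Set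
IsSourceSCC n C = IsSCC n C × NoIncoming n C

{-# OPTIONS --safe #-}
module Submission where

-- Since v₁ + v₂ = n, we have n − v₂ = v₁ and n − v₁ = v₂, so v₁ and v₂ point at each other.
-- Conversely, any arc s → v₂ has s ∣ n − v₂ = v₁, and a prime s ≥ 2 dividing the prime v₁
-- is v₁ itself; likewise for arcs into v₁. Hence every arc into {v₁, v₂} starts inside it,
-- so nothing outside can reach it: the pair is a source strongly connected component.

open import Defs
open import Data.Nat using (ℕ; _+_; _≤_; _∸_; s≤s)
open import Data.Nat.Properties using (m+n∸m≡n; +-comm)
open import Data.Nat.Divisibility using (_∣_; ∣-refl)
open import Data.Nat.Primality using (Prime; prime⇒irreducible)
open import Data.Sum using (_⊎_; inj₁; inj₂)
open import Data.Product using (_,_)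
open import Function using (_∘_; id)
open import Level using (Level)
open import Relation.Unary using (Pred)
open import Relation.Binary using (Rel)
open import Relation.Binary.PropositionalEquality using (_≡_; refl; sym; trans; subst)
open import Relation.Binary.Construct.Closure.ReflexiveTransitive using (Star; ε; _◅_; fold)

star-backward-closed : ∀ {a r p : Level} {A : Set a} {R : Rel A r} (P : Pred A p) →
  (∀ {x y} → R x y → P y → P x) → ∀ {x y} → Star R x y → P y → P x
star-backward-closed P step = fold (λ x y → P y → P x) (λ r k → step r ∘ k) id

nontrivial-divisor-of-prime : ∀ {s p} → 2 ≤ s → Prime p → s ∣ p → s ≡ p
nontrivial-divisor-of-prime 2≤s pp s∣p with prime⇒irreducible pp s∣p | 2≤s
... | inj₁ refl | s≤s ()
... | inj₂ s≡p  | _ = s≡p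

+≡⇒∸≡ : ∀ {m n k} → m + n ≡ k → k ∸ m ≡ n
+≡⇒∸≡ {m} {n} refl = m+n∸m≡n m n

vertex⇒prime : ∀ {n v} → Vertex n v → Prime v
vertex⇒prime (_ , _ , pv) = pv

arc-to-complement : ∀ {n s t} → Vertex n s → Vertex n t → n ∸ t ≡ s → Arc n s t
arc-to-complement {s = s} Vs Vt n∸t≡s = Vs , Vt , subst (s ∣_) (sym n∸t≡s) ∣-refl

arc-into⇒from-complement : ∀ {n s t u} → Prime u → n ∸ t ≡ u → Arc n s t → s ≡ u
arc-into⇒from-complement {s = s} pu n∸t≡u ((2≤s , _) , _ , s∣n∸t) =
  nontrivial-divisor-of-prime 2≤s pu (subst (s ∣_) n∸t≡u s∣n∸t)

mainTheorem14 : (n : ℕ) → 4 ≤ n → 2 ∣ n →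
    (v₁ v₂ : ℕ) → Vertex n v₁ → Vertex n v₂ → v₁ + v₂ ≡ n →
    IsSourceSCC n (λ x → x ≡ v₁ ⊎ x ≡ v₂)
mainTheorem14 n _ _ v₁ v₂ V₁ V₂ sum =
  (inside , (v₁ , inj₁ refl) , connected , maximal) , λ _ _ a Ct ¬Cs → ¬Cs (backward-closed a Ct)
  where
  C : ℕ → Set
  C x = x ≡ v₁ ⊎ x ≡ v₂

  n∸v₁≡v₂ : n ∸ v₁ ≡ v₂
  n∸v₁≡v₂ = +≡⇒∸≡ sum

  n∸v₂≡v₁ : n ∸ v₂ ≡ v₁
  n∸v₂≡v₁ = +≡⇒∸≡ (trans (+-comm v₂ v₁) sum)

  inside : ∀ x → C x → Vertex n x
  inside _ (inj₁ refl) = V₁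
  inside _ (inj₂ refl) = V₂

  connected : ∀ x y → C x → C y → Reach n x y
  connected _ _ (inj₁ refl) (inj₁ refl) = ε
  connected _ _ (inj₂ refl) (inj₂ refl) = ε
  connected _ _ (inj₁ refl) (inj₂ refl) = arc-to-complement V₁ V₂ n∸v₂≡v₁ ◅ ε
  connected _ _ (inj₂ refl) (inj₁ refl) = arc-to-complement V₂ V₁ n∸v₁≡v₂ ◅ ε

  backward-closed : ∀ {s t} → Arc n s t → C t → C s
  backward-closed a (inj₁ refl) = inj₂ (arc-into⇒from-complement (vertex⇒prime {n} V₂) n∸v₁≡v₂ a)
  backward-closed a (inj₂ refl) = inj₁ (arc-into⇒from-complement (vertex⇒prime {n} V₁) n∸v₂≡v₁ a)

  maximal : ∀ x y → C x → Vertex n y → Reach n x y → Reach n y x → C y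
  maximal _ _ Cx _ _ y⇝x = star-backward-closed C backward-closed y⇝x Cx
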